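{- Let $k\geq 2$ be an integer. Then the numbers $C_{2^1-1}, C_{2^2-1},\ldots, C_{2^{k-1}-1}$ are pairwise distinct modulo $2^k$, and for every integer $n\geq k-1$ one has $C_{2^n-1}\equiv C_{2^{k-1}-1}\pmod{2^k}$ (i.e. modulo $2^k$ the sequence $(C_{2^n-1})_{n\geq1}$ is constant from rank $k-1$ on).
   Context: $C_n := \frac{(2n)!}{(n+1)!\,n!}$ denotes the $n$-th Catalan number. -}

module Defs where

open import Data.Nat using (ℕ; suc; _*_; _^_; _∸_; _%_; _/_; _!)
open import Data.Nat.Properties using (_!*_!≢0; m^n≢0)
open import Relation.Binary.PropositionalEquality using (_≡_)

Catalan : ℕ → ℕ
Catalan n = ((2 * n) ! / (suc n ! * n !)) {{suc n !* n !≢0}}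

_≡_mod2^_ : ℕ → ℕ → ℕ → Set
a ≡ b mod2^ k = (a % (2 ^ k)) {{m^n≢0 2 k}} ≡ (b % (2 ^ k)) {{m^n≢0 2 k}}

{-# OPTIONS --safe #-}
module Submission where

-- Write N = 2ⁿ with n ≥ 1. From (2N)! = 2ᴺ · N! · (2N − 1)!! one gets the exact identity
--   C_{2N−1} · (4N − 1) · (2N − 1)!! = C_{N−1} · (2N − 1) · ∏_{i<N} (2N + 2i + 1),
-- whose last product is ≡ (2N − 1)!! (mod 4N) since N is even. That odd factor cancels modulo the
-- power of two 4N, leaving C_{2N−1} ≡ −(2N − 1) · C_{N−1} ≡ C_{N−1} + 2N (mod 4N) because C_{N−1}
-- is odd (which propagates by the same congruence). So C_{2^{n+1}−1} agrees with C_{2ⁿ−1} modulo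
-- 2^{n+1} but not modulo 2^{n+2}, which gives both the stabilisation and the distinctness.

open import Defs
open import Data.Nat
  using (ℕ; zero; suc; _+_; _*_; _≤_; _<_; _≤′_; ≤′-refl; ≤′-step; _∸_; _^_; _%_; _/_; _!; NonZero; ≢-nonZero; z≤n; s≤s)
open import Data.Nat.Properties
open import Data.Nat.DivMod
  using (m≡m%n+[m/n]*n; [m+kn]%n≡m%n; %-remove-+ˡ; %-remove-+ʳ; m/n*n≡m; m∣n⇒o%n%m≡o%m)
open import Data.Nat.Divisibility
open import Data.Nat.Combinatorics using (k![n∸k]!∣n!)
open import Data.Nat.Primality using (Prime; prime[2]; prime⇒nonZero; euclidsLemma)
open import Data.Nat.Tactic.RingSolver using (solve-∀)
open import Data.Product using (∃; _×_; _,_; proj₁; proj₂)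
open import Data.Sum using (inj₁; inj₂)
open import Relation.Nullary using (¬_; contradiction)
open import Relation.Binary.PropositionalEquality
open import Relation.Binary.Definitions using (tri<; tri≈; tri>)
open import Function using (_∘_)
open ≡-Reasoning

^-monoʳ-∣ : ∀ m {k l} → k ≤ l → m ^ k ∣ m ^ l
^-monoʳ-∣ m {k} {l} k≤l = divides (m ^ (l ∸ k)) (begin
  m ^ l             ≡⟨ cong (m ^_) (m∸n+n≡m k≤l) ⟨
  m ^ (l ∸ k + k)   ≡⟨ ^-distribˡ-+-* m (l ∸ k) k ⟩
  m ^ (l ∸ k) * m ^ k ∎)

prime-power-divisor : ∀ {p} k {o x} → Prime p → ¬ p ∣ o → p ^ k ∣ o * x → p ^ k ∣ x
prime-power-divisor zero _ _ _ = 1∣ _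
prime-power-divisor {p} (suc k) {o} {x} pr p∤o p^k+1∣ox
  with euclidsLemma o x pr (m*n∣⇒m∣ p (p ^ k) p^k+1∣ox)
... | inj₁ p∣o = contradiction p∣o p∤o
... | inj₂ (divides y refl) =
  subst (_∣ y * p) (*-comm (p ^ k) p) (*-monoˡ-∣ p (prime-power-divisor k pr p∤o p^k∣oy))
  where
  instance
    p≢0 : NonZero p
    p≢0 = prime⇒nonZero pr
  p^k∣oy : p ^ k ∣ o * y
  p^k∣oy = *-cancelˡ-∣ p (subst (p * p ^ k ∣_) (shuffle o y p) p^k+1∣ox)
    where shuffle : ∀ o y p → o * (y * p) ≡ p * (o * y)
          shuffle = solve-∀

¬2∣odd : ∀ s → ¬ 2 ∣ 1 + 2 * s
¬2∣odd s 2∣1+2s =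
  contradiction (∣1⇒≡1 (∣m+n∣m⇒∣n (subst (2 ∣_) (+-comm 1 (2 * s)) 2∣1+2s) (m∣m*n s))) λ ()

mod2^-weaken : ∀ {a b k l} → k ≤ l → a ≡ b mod2^ l → a ≡ b mod2^ k
mod2^-weaken {a} {b} {k} {l} k≤l a≡b = begin
  a % 2 ^ k         ≡⟨ m∣n⇒o%n%m≡o%m (2 ^ k) (2 ^ l) a 2^k∣2^l ⟨
  a % 2 ^ l % 2 ^ k ≡⟨ cong (_% 2 ^ k) a≡b ⟩
  b % 2 ^ l % 2 ^ k ≡⟨ m∣n⇒o%n%m≡o%m (2 ^ k) (2 ^ l) b 2^k∣2^l ⟩
  b % 2 ^ k         ∎
  where
  instance
    2^k≢0 : NonZero (2 ^ k)
    2^k≢0 = m^n≢0 2 k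
    2^l≢0 : NonZero (2 ^ l)
    2^l≢0 = m^n≢0 2 l
  2^k∣2^l : 2 ^ k ∣ 2 ^ l
  2^k∣2^l = ^-monoʳ-∣ 2 k≤l

+2^-mod2^ : ∀ a {k l} → k ≤ l → (a + 2 ^ l) ≡ a mod2^ k
+2^-mod2^ a {k} k≤l = %-remove-+ʳ a {{m^n≢0 2 k}} (^-monoʳ-∣ 2 k≤l)

≢+2^-mod2^ : ∀ a k → ¬ (a ≡ (a + 2 ^ k) mod2^ suc k)
≢+2^-mod2^ a k a≡a+h = even≢odd q′ q (*-cancelʳ-≡ (2 * q′) (suc (2 * q)) h (begin
  2 * q′ * h          ≡⟨ even-multiple q′ h ⟩
  q′ * M              ≡⟨ +-cancelˡ-≡ (a % M) _ _ (trans both-sides (+-assoc (a % M) (q * M) h)) ⟩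
  q * M + h           ≡⟨ odd-multiple q h ⟩
  suc (2 * q) * h     ∎))
  where
  h = 2 ^ k
  M = 2 ^ suc k
  instance
    h≢0 : NonZero h
    h≢0 = m^n≢0 2 k
    M≢0 : NonZero M
    M≢0 = m^n≢0 2 (suc k)
  q = a / M
  q′ = (a + h) / M
  both-sides : a % M + q′ * M ≡ a % M + q * M + h
  both-sides = begin
    a % M + q′ * M         ≡⟨ cong (_+ q′ * M) a≡a+h ⟩
    (a + h) % M + q′ * M   ≡⟨ m≡m%n+[m/n]*n (a + h) M ⟨
    a + h                  ≡⟨ cong (_+ h) (m≡m%n+[m/n]*n a M) ⟩
    a % M + q * M + h      ∎
  even-multiple : ∀ q h → 2 * q * h ≡ q * (2 * h)
  even-multiple = solve-∀
  odd-multiple : ∀ q h → q * (2 * h) + h ≡ suc (2 * q) * h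
  odd-multiple = solve-∀

oddProductFrom : ℕ → ℕ → ℕ
oddProductFrom c zero    = 1
oddProductFrom c (suc n) = oddProductFrom c n * (c + suc (2 * n))

oddProduct : ℕ → ℕ
oddProduct = oddProductFrom 0

oddProductFrom-+ : ∀ c m n → oddProductFrom c (m + n) ≡ oddProductFrom c m * oddProductFrom (c + 2 * m) n
oddProductFrom-+ c m zero = trans (cong (oddProductFrom c) (+-identityʳ m)) (sym (*-identityʳ _))
oddProductFrom-+ c m (suc n) = begin
  oddProductFrom c (m + suc n)                        ≡⟨ cong (oddProductFrom c) (+-suc m n) ⟩
  oddProductFrom c (m + n) * (c + suc (2 * (m + n)))  ≡⟨ cong (_* (c + suc (2 * (m + n)))) (oddProductFrom-+ c m n) ⟩
  P * Q * (c + suc (2 * (m + n)))                     ≡⟨ regroup P Q c m n ⟩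
  P * oddProductFrom (c + 2 * m) (suc n)              ∎
  where
  P = oddProductFrom c m
  Q = oddProductFrom (c + 2 * m) n
  regroup : ∀ P Q c m n → P * Q * (c + suc (2 * (m + n))) ≡ P * (Q * (c + 2 * m + suc (2 * n)))
  regroup = solve-∀

oddProduct-odd : ∀ n → ∃ λ s → oddProduct n ≡ 1 + 2 * s
oddProduct-odd zero = 0 , refl
oddProduct-odd (suc n) with oddProduct-odd n
... | s , O≡1+2s = s + n + 2 * s * n , trans (cong (_* suc (2 * n)) O≡1+2s) (expand s n)
  where
  expand : ∀ s n → (1 + 2 * s) * suc (2 * n) ≡ 1 + 2 * (s + n + 2 * s * n)
  expand = solve-∀

¬2∣oddProduct : ∀ n → ¬ 2 ∣ oddProduct n
¬2∣oddProduct n with oddProduct-odd n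
... | s , O≡1+2s = subst (λ o → ¬ 2 ∣ o) (sym O≡1+2s) (¬2∣odd s)

-- ∏ (2e + aᵢ) ≡ ∏ aᵢ + 2e · Σᵢ ∏_{j≠i} aⱼ (mod 4e), and the n products in the sum are odd.
oddProductFrom-2* : ∀ e n → ∃ λ r → oddProductFrom (2 * e) n ≡ oddProduct n + 2 * e * n + 4 * e * r
oddProductFrom-2* e zero = 0 , sym (cong₂ (λ x y → 1 + x + y) (*-zeroʳ (2 * e)) (*-zeroʳ (4 * e)))
oddProductFrom-2* e (suc n) with oddProductFrom-2* e n | oddProduct-odd n
... | r , P≡ | s , O≡1+2s = s + e * n + n * n + r * (2 * e + 2 * n + 1) , (begin
  oddProductFrom (2 * e) n * (2 * e + suc (2 * n))         ≡⟨ cong (_* (2 * e + suc (2 * n))) P≡ ⟩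
  (O + 2 * e * n + 4 * e * r) * (2 * e + suc (2 * n))     ≡⟨ split O e n r ⟩
  O * suc (2 * n) + 2 * e * O + X                          ≡⟨ cong (λ o → O * suc (2 * n) + 2 * e * o + X) O≡1+2s ⟩
  O * suc (2 * n) + 2 * e * (1 + 2 * s) + X                ≡⟨ collect O e n r s ⟩
  O * suc (2 * n) + 2 * e * suc n + 4 * e * (s + e * n + n * n + r * (2 * e + 2 * n + 1)) ∎)
  where
  O = oddProduct n
  X = (2 * e * n + 4 * e * r) * (2 * e + suc (2 * n))
  split : ∀ O e n r → (O + 2 * e * n + 4 * e * r) * (2 * e + suc (2 * n))
                   ≡ O * suc (2 * n) + 2 * e * O + (2 * e * n + 4 * e * r) * (2 * e + suc (2 * n))
  split = solve-∀
  collect : ∀ O e n r s → O * suc (2 * n) + 2 * e * (1 + 2 * s) + (2 * e * n + 4 * e * r) * (2 * e + suc (2 * n))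
                        ≡ O * suc (2 * n) + 2 * e * suc n + 4 * e * (s + e * n + n * n + r * (2 * e + 2 * n + 1))
  collect = solve-∀

2*suc : ∀ n → 2 * suc n ≡ suc (suc (2 * n))
2*suc = solve-∀

[2n]!≡2^n*n!*oddProduct : ∀ n → (2 * n) ! ≡ 2 ^ n * n ! * oddProduct n
[2n]!≡2^n*n!*oddProduct zero = refl
[2n]!≡2^n*n!*oddProduct (suc n) = begin
  (2 * suc n) !                                          ≡⟨ cong _! (2*suc n) ⟩
  suc (suc (2 * n)) * (suc (2 * n) * (2 * n) !)
    ≡⟨ cong (λ f → suc (suc (2 * n)) * (suc (2 * n) * f)) ([2n]!≡2^n*n!*oddProduct n) ⟩
  suc (suc (2 * n)) * (suc (2 * n) * (2 ^ n * n ! * oddProduct n)) ≡⟨ regroup n (2 ^ n) (n !) (oddProduct n) ⟩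
  2 * 2 ^ n * (suc n * n !) * (oddProduct n * suc (2 * n)) ∎
  where
  regroup : ∀ n P F O → suc (suc (2 * n)) * (suc (2 * n) * (P * F * O))
                      ≡ 2 * P * (suc n * F) * (O * suc (2 * n))
  regroup = solve-∀

[1+n]!*n!∣[2n]! : ∀ n → suc n ! * n ! ∣ (2 * n) !
[1+n]!*n!∣[2n]! zero = ∣-refl
[1+n]!*n!∣[2n]! n@(suc p) = ∣m+n∣m⇒∣n (subst (suc n ! * n ! ∣_) (+-comm F (n * F)) X∣[1+n]F) X∣nF
  where
  F = (2 * n) !
  n!n!∣F : n ! * n ! ∣ F
  n!n!∣F = subst (λ j → n ! * j ! ∣ F) (trans (m+n∸m≡n n (n + 0)) (+-identityʳ n)) (k![n∸k]!∣n! (m≤n*m n 2))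
  [1+n]!p!∣F : suc n ! * p ! ∣ F
  [1+n]!p!∣F = subst (λ j → suc n ! * j ! ∣ F) (trans (cong (_∸ suc n) (split p)) (m+n∸n≡m p (suc n)))
                 (k![n∸k]!∣n! (subst (suc n ≤_) (sym (split p)) (m≤n+m (suc n) p)))
    where split : ∀ p → 2 * suc p ≡ p + suc (suc p)
          split = solve-∀
  X∣[1+n]F : suc n ! * n ! ∣ suc n * F
  X∣[1+n]F = subst (_∣ suc n * F) (sym (*-assoc (suc n) (n !) (n !))) (*-monoʳ-∣ (suc n) n!n!∣F)
  X∣nF : suc n ! * n ! ∣ n * F
  X∣nF = subst (_∣ n * F) (regroup n (suc n !) (p !)) (*-monoʳ-∣ n [1+n]!p!∣F)
    where regroup : ∀ n a b → n * (a * b) ≡ a * (n * b)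
          regroup = solve-∀

Catalan*[1+n]!*n!≡[2n]! : ∀ n → Catalan n * (suc n ! * n !) ≡ (2 * n) !
Catalan*[1+n]!*n!≡[2n]! n = m/n*n≡m {{suc n !* n !≢0}} ([1+n]!*n!∣[2n]! n)

Catalan-oddProduct : ∀ n →
  Catalan n * suc (2 * n) * 2 * suc n ! ≡ 2 ^ suc n * oddProduct (suc n)
Catalan-oddProduct n = *-cancelʳ-≡ _ _ (suc n !) {{suc n !≢0}} (begin
  C * suc (2 * n) * 2 * suc n ! * suc n !                       ≡⟨ regroup C n (n !) ⟩
  suc (suc (2 * n)) * (suc (2 * n) * (C * (suc n ! * n !)))
    ≡⟨ cong (λ f → suc (suc (2 * n)) * (suc (2 * n) * f)) (Catalan*[1+n]!*n!≡[2n]! n) ⟩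
  suc (suc (2 * n)) !                                           ≡⟨ cong _! (2*suc n) ⟨
  (2 * suc n) !                                                 ≡⟨ [2n]!≡2^n*n!*oddProduct (suc n) ⟩
  2 ^ suc n * suc n ! * oddProduct (suc n)                      ≡⟨ *-assoc (2 ^ suc n) _ _ ⟩
  2 ^ suc n * (suc n ! * oddProduct (suc n))                    ≡⟨ cong (2 ^ suc n *_) (*-comm (suc n !) _) ⟩
  2 ^ suc n * (oddProduct (suc n) * suc n !)                    ≡⟨ *-assoc (2 ^ suc n) _ _ ⟨
  2 ^ suc n * oddProduct (suc n) * suc n !                      ∎)
  where
  C = Catalan n
  regroup : ∀ C n F → C * suc (2 * n) * 2 * (suc n * F) * (suc n * F)
                    ≡ suc (suc (2 * n)) * (suc (2 * n) * (C * (suc n * F * F)))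
  regroup = solve-∀

Catalan[2n+1]-oddProductFrom : ∀ n →
  Catalan (suc (2 * n)) * suc (2 * suc (2 * n)) * 2 * suc n !
    ≡ 2 ^ suc n * oddProductFrom (2 * suc n) (suc n)
Catalan[2n+1]-oddProductFrom n =
  *-cancelʳ-≡ _ _ (P * O) {{m*n≢0 P O {{m^n≢0 2 N}} {{O≢0}}}} (begin
    D * N ! * (P * O)                   ≡⟨ regroup₁ D (N !) P O ⟩
    D * (P * N ! * O)                   ≡⟨ cong (D *_) ([2n]!≡2^n*n!*oddProduct N) ⟨
    D * (2 * N) !                       ≡⟨ cong (λ i → D * i !) (2*suc n) ⟩
    D * suc (suc (2 * n)) !             ≡⟨ Catalan-oddProduct (suc (2 * n)) ⟩
    2 ^ suc (suc (2 * n)) * oddProduct (suc (suc (2 * n))) ≡⟨ cong (λ i → 2 ^ i * oddProduct i) (double n) ⟩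
    2 ^ (N + N) * oddProduct (N + N)    ≡⟨ cong₂ _*_ (^-distribˡ-+-* 2 N N) (oddProductFrom-+ 0 N N) ⟩
    P * P * (O * S)                     ≡⟨ regroup₂ P O S ⟩
    P * S * (P * O)                     ∎)
  where
  N = suc n
  P = 2 ^ N
  O = oddProduct N
  S = oddProductFrom (2 * N) N
  D = Catalan (suc (2 * n)) * suc (2 * suc (2 * n)) * 2
  O≢0 : NonZero O
  O≢0 = ≢-nonZero λ O≡0 → ¬2∣oddProduct N (subst (2 ∣_) (sym O≡0) (2 ∣0))
  double : ∀ n → suc (suc (2 * n)) ≡ suc n + suc n
  double = solve-∀
  regroup₁ : ∀ D F P O → D * F * (P * O) ≡ D * (P * F * O)
  regroup₁ = solve-∀
  regroup₂ : ∀ P O S → P * P * (O * S) ≡ P * S * (P * O)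
  regroup₂ = solve-∀

Catalan-doubling : ∀ n →
  Catalan (suc (2 * n)) * suc (2 * suc (2 * n)) * oddProduct (suc n)
    ≡ Catalan n * suc (2 * n) * oddProductFrom (2 * suc n) (suc n)
Catalan-doubling n = *-cancelʳ-≡ _ _ (2 * suc n !) {{m*n≢0 2 (suc n !) {{_}} {{suc n !≢0}}}} (begin
  C′ * q * O * (2 * F)    ≡⟨ regroup₁ C′ q O F ⟩
  C′ * q * 2 * F * O      ≡⟨ cong (_* O) (Catalan[2n+1]-oddProductFrom n) ⟩
  P * S * O               ≡⟨ regroup₂ P S O ⟩
  P * O * S               ≡⟨ cong (_* S) (Catalan-oddProduct n) ⟨
  C * r * 2 * F * S       ≡⟨ regroup₃ C r F S ⟩
  C * r * S * (2 * F)     ∎)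
  where
  C = Catalan n
  C′ = Catalan (suc (2 * n))
  r = suc (2 * n)
  q = suc (2 * suc (2 * n))
  F = suc n !
  P = 2 ^ suc n
  O = oddProduct (suc n)
  S = oddProductFrom (2 * suc n) (suc n)
  regroup₁ : ∀ C′ q O F → C′ * q * O * (2 * F) ≡ C′ * q * 2 * F * O
  regroup₁ = solve-∀
  regroup₂ : ∀ P S O → P * S * O ≡ P * O * S
  regroup₂ = solve-∀
  regroup₃ : ∀ C r F S → C * r * 2 * F * S ≡ C * r * S * (2 * F)
  regroup₃ = solve-∀

-- For N = n + 1 even, oddProductFrom 2N N ≡ oddProduct N (mod 4N) by oddProductFrom-2*,
-- while 4n + 3 ≡ -1; so modulo 4N the doubling identity reads -C₂ₙ₊₁ · O ≡ Cₙ · (2n + 1) · O.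
Catalan-doubling-∣ : ∀ n h → suc n ≡ 2 * h →
  2 * (2 * suc n) ∣ oddProduct (suc n) * (Catalan (suc (2 * n)) + suc (2 * n) * Catalan n)
Catalan-doubling-∣ n h N≡2h =
  ∣m+n∣m⇒∣n (subst (W ∣_) (sym key) (m∣m*n (C′ * O))) (m∣m*n (C * r * R))
  where
  N = suc n
  W = 2 * (2 * N)
  C = Catalan n
  C′ = Catalan (suc (2 * n))
  r = suc (2 * n)
  O = oddProduct N
  S = oddProductFrom (2 * N) N
  R′ = proj₁ (oddProductFrom-2* N N)
  R = h + R′
  S≡O+W*R : S ≡ O + W * R
  S≡O+W*R = begin
    S                             ≡⟨ proj₂ (oddProductFrom-2* N N) ⟩
    O + 2 * N * N + 4 * N * R′    ≡⟨ cong (λ x → O + 2 * N * x + 4 * N * R′) N≡2h ⟩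
    O + 2 * N * (2 * h) + 4 * N * R′ ≡⟨ regroup O N h R′ ⟩
    O + W * R                     ∎
    where regroup : ∀ O N h R′ → O + 2 * N * (2 * h) + 4 * N * R′ ≡ O + 2 * (2 * N) * (h + R′)
          regroup = solve-∀
  key : W * (C * r * R) + O * (C′ + r * C) ≡ W * (C′ * O)
  key = begin
    W * (C * r * R) + O * (C′ + r * C)   ≡⟨ expand W C r R O C′ ⟩
    C * r * (O + W * R) + C′ * O          ≡⟨ cong (λ s → C * r * s + C′ * O) S≡O+W*R ⟨
    C * r * S + C′ * O                    ≡⟨ cong (_+ C′ * O) (Catalan-doubling n) ⟨
    C′ * suc (2 * suc (2 * n)) * O + C′ * O ≡⟨ collect C′ n O ⟩
    W * (C′ * O)                          ∎
    where expand : ∀ W C r R O C′ → W * (C * r * R) + O * (C′ + r * C) ≡ C * r * (O + W * R) + C′ * O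
          expand = solve-∀
          collect : ∀ C′ n O → C′ * suc (2 * suc (2 * n)) * O + C′ * O ≡ 2 * (2 * suc n) * (C′ * O)
          collect = solve-∀

m%2≡1⇒m≡1+2*[m/2] : ∀ {m} → m ≡ 1 mod2^ 1 → m ≡ 1 + 2 * (m / 2)
m%2≡1⇒m≡1+2*[m/2] {m} m%2≡1 = begin
  m                 ≡⟨ m≡m%n+[m/n]*n m 2 ⟩
  m % 2 + m / 2 * 2 ≡⟨ cong₂ _+_ m%2≡1 (*-comm (m / 2) 2) ⟩
  1 + 2 * (m / 2)   ∎

Catalan-doubling-mod2^ : ∀ k n → suc n ≡ 2 ^ suc k → Catalan n ≡ 1 mod2^ 1 →
  Catalan (suc (2 * n)) ≡ (Catalan n + 2 ^ suc (suc k)) mod2^ suc (suc (suc k))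
Catalan-doubling-mod2^ k n N≡2^[1+k] C-odd = begin
  C′ % M                         ≡⟨ [m+kn]%n≡m%n C′ (suc t) M ⟨
  (C′ + suc t * M) % M           ≡⟨ cong (_% M) rearrange ⟩
  (C′ + r * C + (C + D)) % M     ≡⟨ %-remove-+ˡ (C + D) M∣C′+r*C ⟩
  (C + D) % M                    ∎
  where
  C = Catalan n
  C′ = Catalan (suc (2 * n))
  r = suc (2 * n)
  t = C / 2
  D = 2 ^ suc (suc k)
  M = 2 ^ suc (suc (suc k))
  instance
    M≢0 : NonZero M
    M≢0 = m^n≢0 2 (suc (suc (suc k)))
  D≡2N : D ≡ 2 * suc n
  D≡2N = cong (2 *_) (sym N≡2^[1+k])
  M∣C′+r*C : M ∣ C′ + r * C
  M∣C′+r*C = prime-power-divisor (suc (suc (suc k))) prime[2] (¬2∣oddProduct (suc n))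
    (subst (_∣ oddProduct (suc n) * (C′ + r * C)) (cong (λ x → 2 * (2 * x)) N≡2^[1+k])
      (Catalan-doubling-∣ n (2 ^ k) N≡2^[1+k]))
  rearrange : C′ + suc t * M ≡ C′ + r * C + (C + D)
  rearrange = begin
    C′ + suc t * (2 * D)                        ≡⟨ cong (λ d → C′ + suc t * (2 * d)) D≡2N ⟩
    C′ + suc t * (2 * (2 * suc n))              ≡⟨ regroup C′ t n ⟩
    C′ + r * (1 + 2 * t) + (1 + 2 * t + 2 * suc n) ≡⟨ cong (λ c → C′ + r * c + (c + 2 * suc n)) (m%2≡1⇒m≡1+2*[m/2] C-odd) ⟨
    C′ + r * C + (C + 2 * suc n)                ≡⟨ cong (λ d → C′ + r * C + (C + d)) D≡2N ⟨
    C′ + r * C + (C + D)                        ∎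
    where regroup : ∀ C′ t n → C′ + suc t * (2 * (2 * suc n))
                             ≡ C′ + suc (2 * n) * (1 + 2 * t) + (1 + 2 * t + 2 * suc n)
          regroup = solve-∀

mersenneCatalan : ℕ → ℕ
mersenneCatalan n = Catalan (2 ^ n ∸ 1)

mersenneCatalan-step : ∀ k → mersenneCatalan (suc k) ≡ 1 mod2^ 1 →
  mersenneCatalan (suc (suc k)) ≡ (mersenneCatalan (suc k) + 2 ^ suc (suc k)) mod2^ suc (suc (suc k))
mersenneCatalan-step k odd =
  subst (λ i → Catalan i ≡ (mersenneCatalan (suc k) + 2 ^ suc (suc k)) mod2^ suc (suc (suc k))) (sym index)
    (Catalan-doubling-mod2^ k n (sym 2^[1+k]≡suc[n]) odd)
  where
  n = 2 ^ suc k ∸ 1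
  2^[1+k]≡suc[n] : 2 ^ suc k ≡ suc n
  2^[1+k]≡suc[n] = sym (m+[n∸m]≡n (m^n>0 2 (suc k)))
  index : 2 ^ suc (suc k) ∸ 1 ≡ suc (2 * n)
  index = trans (cong (λ x → 2 * x ∸ 1) 2^[1+k]≡suc[n]) (cong (_∸ 1) (2*suc n))

mersenneCatalan-odd : ∀ n → mersenneCatalan n ≡ 1 mod2^ 1
mersenneCatalan-odd zero = refl
mersenneCatalan-odd (suc zero) = refl
mersenneCatalan-odd (suc (suc k)) =
  trans (mod2^-weaken {b = A₁ + 2 ^ suc (suc k)} {k = 1} {l = suc (suc (suc k))} (s≤s z≤n)
          (mersenneCatalan-step k (mersenneCatalan-odd (suc k))))
        (trans (+2^-mod2^ A₁ {k = 1} {l = suc (suc k)} (s≤s z≤n)) (mersenneCatalan-odd (suc k)))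
  where A₁ = mersenneCatalan (suc k)

mersenneCatalan-suc : ∀ n → 1 ≤ n →
  mersenneCatalan (suc n) ≡ (mersenneCatalan n + 2 ^ suc n) mod2^ suc (suc n)
mersenneCatalan-suc (suc k) _ = mersenneCatalan-step k (mersenneCatalan-odd (suc k))

mersenneCatalan-stable : ∀ {j n} → 1 ≤ j → j ≤′ n → mersenneCatalan n ≡ mersenneCatalan j mod2^ suc j
mersenneCatalan-stable _ ≤′-refl = refl
mersenneCatalan-stable {j} 1≤j (≤′-step {n} j≤′n) =
  trans (mod2^-weaken {l = suc n} (s≤s j≤n) A[1+n]≡A[n]) (mersenneCatalan-stable 1≤j j≤′n)
  where
  j≤n = ≤′⇒≤ j≤′n
  A[1+n]≡A[n] : mersenneCatalan (suc n) ≡ mersenneCatalan n mod2^ suc n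
  A[1+n]≡A[n] = trans (mod2^-weaken {b = mersenneCatalan n + 2 ^ suc n} {l = suc (suc n)} (n≤1+n (suc n))
                         (mersenneCatalan-suc n (≤-trans 1≤j j≤n)))
                       (+2^-mod2^ (mersenneCatalan n) {k = suc n} ≤-refl)

mersenneCatalan-distinct : ∀ {i j k} → 1 ≤ i → i < j → j < k →
  ¬ (mersenneCatalan i ≡ mersenneCatalan j mod2^ k)
mersenneCatalan-distinct {i} {j} {k} 1≤i i<j j<k Aᵢ≡Aⱼ = ≢+2^-mod2^ (mersenneCatalan i) (suc i)
  (trans (mod2^-weaken {b = mersenneCatalan j} {l = k} (≤-trans (s≤s i<j) j<k) Aᵢ≡Aⱼ)
    (trans (mersenneCatalan-stable (s≤s z≤n) (≤⇒≤′ i<j)) (mersenneCatalan-suc i 1≤i)))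

theorem1p2 : (k : ℕ) → 2 ≤ k →
    ((i j : ℕ) → 1 ≤ i → i ≤ k ∸ 1 → 1 ≤ j → j ≤ k ∸ 1 → ¬ (i ≡ j) →
      ¬ (Catalan (2 ^ i ∸ 1) ≡ Catalan (2 ^ j ∸ 1) mod2^ k))
    × ((n : ℕ) → k ∸ 1 ≤ n →
      Catalan (2 ^ n ∸ 1) ≡ Catalan (2 ^ (k ∸ 1) ∸ 1) mod2^ k)
theorem1p2 (suc (suc k)) (s≤s (s≤s z≤n)) =
  distinct , λ n k+1≤n → mersenneCatalan-stable (s≤s z≤n) (≤⇒≤′ k+1≤n)
  where
  distinct : (i j : ℕ) → 1 ≤ i → i ≤ suc k → 1 ≤ j → j ≤ suc k → ¬ (i ≡ j) →
             ¬ (mersenneCatalan i ≡ mersenneCatalan j mod2^ suc (suc k))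
  distinct i j 1≤i i≤k+1 1≤j j≤k+1 i≢j with <-cmp i j
  ... | tri< i<j _ _ = mersenneCatalan-distinct 1≤i i<j (s≤s j≤k+1)
  ... | tri≈ _ i≡j _ = contradiction i≡j i≢j
  ... | tri> _ _ j<i = mersenneCatalan-distinct 1≤j j<i (s≤s i≤k+1) ∘ sym
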